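{- Let $G$ be a planar graph with vertex set $V=\{v_1,\dots,v_n\}$ and let $k\in\mathbb{N}$. Construct $G'$ as follows: take vertices $V'=\{v'_1,\dots,v'_n\}$ with $v'_iv'_j$ an edge iff $v_iv_j\in E(G)$; take vertices $V''=\{v''_1,\dots,v''_n\}$ with $v''_i$ adjacent only to $v'_i$; and for each edge $v_iv_j\in E(G)$ with $i<j$ add four new vertices $e^1_{ij},e^2_{ij},e^3_{ij},e^4_{ij}$ forming the path $e^1_{ij}e^2_{ij}e^3_{ij}e^4_{ij}$, with $v'_i$ adjacent to $e^1_{ij}$ and $e^4_{ij}$, and $v'_j$ adjacent to $e^2_{ij}$ and $e^3_{ij}$. There are no other edges. Then $G$ has an independent set of size $k$ if and only if $G'$ has a pair of perfectly matched sets of size $k+2|E(G)|$.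
   Context: All graphs are finite, simple and undirected. In a graph, a pair $(A,B)$ is a pair of perfectly matched sets if $A$ and $B$ are disjoint vertex subsets, every vertex of $A$ has exactly one neighbor in $B$, and every vertex of $B$ has exactly one neighbor in $A$; its size is $|A|=|B|$. -}

module Defs where

open import Data.Nat using (ℕ; _+_; _*_; _<ᵇ_)
open import Data.Bool using (Bool; true; false; _∧_)
open import Data.Fin using (Fin; toℕ; _<_; zero; suc)
open import Data.List using (List; length; filterᵇ; cartesianProduct; allFin)
open import Data.List.Membership.Propositional using (_∈_; _∉_)
open import Data.List.Relation.Unary.Unique.Propositional using (Unique)
open import Data.List.Relation.Unary.AllPairs using (AllPairs)
open import Data.Product using (Σ; Σ-syntax; ∃; ∃-syntax; _×_; _,_; proj₁; proj₂)
open import Data.Sum using (_⊎_)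
open import Relation.Binary.PropositionalEquality using (_≡_)
open import Relation.Nullary using (¬_)

record Graph (n : ℕ) : Set where
  field
    adj   : Fin n → Fin n → Bool
    sym   : ∀ i j → adj i j ≡ adj j i
    irrefl : ∀ i → adj i i ≡ false
open Graph public

module _ {n : ℕ} (G : Graph n) where

  Edge : Set
  Edge = Σ[ i ∈ Fin n ] Σ[ j ∈ Fin n ] (i < j × adj G i j ≡ true)

  numEdges : ℕ
  numEdges = length (filterᵇ (λ p → (toℕ (proj₁ p) <ᵇ toℕ (proj₂ p)) ∧ adj G (proj₁ p) (proj₂ p))
                             (cartesianProduct (allFin n) (allFin n)))

  HasIndependentSet : ℕ → Set
  HasIndependentSet k =
    Σ[ S ∈ List (Fin n) ] (Unique S × length S ≡ k × AllPairs (λ x y → adj G x y ≡ false) S)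

  -- vertices of G': orig i = v'_i, pend i = v''_i,
  -- gad e t = e^{t+1}_{ij} for the edge e = v_i v_j (i < j), t ∈ {0,1,2,3}
  data V' : Set where
    orig : Fin n → V'
    pend : Fin n → V'
    gad  : Edge → Fin 4 → V'

  lo hi : Edge → Fin n
  lo e = proj₁ e
  hi e = proj₁ (proj₂ e)

  data Arc : V' → V' → Set where
    orig-orig : ∀ i j → adj G i j ≡ true → Arc (orig i) (orig j)
    orig-pend : ∀ i → Arc (orig i) (pend i)
    path12    : ∀ e → Arc (gad e zero) (gad e (suc zero))
    path23    : ∀ e → Arc (gad e (suc zero)) (gad e (suc (suc zero)))
    path34    : ∀ e → Arc (gad e (suc (suc zero))) (gad e (suc (suc (suc zero))))
    lo-e1     : ∀ e → Arc (orig (lo e)) (gad e zero)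
    lo-e4     : ∀ e → Arc (orig (lo e)) (gad e (suc (suc (suc zero))))
    hi-e2     : ∀ e → Arc (orig (hi e)) (gad e (suc zero))
    hi-e3     : ∀ e → Arc (orig (hi e)) (gad e (suc (suc zero)))

  Adj' : V' → V' → Set
  Adj' x y = Arc x y ⊎ Arc y x

  PerfectlyMatched : List V' → List V' → Set
  PerfectlyMatched A B =
    Unique A × Unique B × (∀ x → x ∈ A → x ∉ B) ×
    (∀ a → a ∈ A → Σ[ b ∈ V' ] (b ∈ B × Adj' a b × (∀ b' → b' ∈ B → Adj' a b' → b' ≡ b))) ×
    (∀ b → b ∈ B → Σ[ a ∈ V' ] (a ∈ A × Adj' b a × (∀ a' → a' ∈ A → Adj' b a' → a' ≡ a)))

  HasPMS' : ℕ → Set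
  HasPMS' m = Σ[ A ∈ List V' ] Σ[ B ∈ List V' ] (PerfectlyMatched A B × length A ≡ m)

-- Forward: for an independent set S, match v'_i with v''_i for i ∈ S and, in every edge
-- gadget, the rungs e¹e² and e³e⁴, each oriented so that the side adjacent to a v'_k with
-- k ∈ S lies in A; this gives |S| + 2|E| perfectly matched pairs.
-- Backward: charge every matched pair to one of its vertices, namely a v'_i if the pair
-- contains one (the A-side one if both), else e¹ for the rung e¹e² and e³ for the rungs
-- e²e³ and e³e⁴, which share e³. Matched pairs are vertex-disjoint, so charging is
-- injective. If both ends v'_i, v'_j of an edge are charged, the rung e¹e² cannot be
-- matched; dropping the smaller end of every such edge from the charged v'_i leaves an
-- independent set I, and the charges inject into I, the e³'s, and one spare slot per edge,
-- so |A| ≤ |I| + 2|E|.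
module Submission where

open import Defs
open import Data.Nat using (ℕ; _+_; _*_; _≤_; z≤n; s≤s; _<ᵇ_)
open import Function.Bundles using (_⇔_; Equivalence; mk⇔)

open import Axiom.UniquenessOfIdentityProofs using (module Decidable⇒UIP)
open import Data.Bool using (Bool; true; false; T; T?; _∧_)
import Data.Bool.Properties as Bool
open import Data.Empty using (⊥; ⊥-elim)
open import Data.Fin using (Fin; zero; suc; toℕ; _<_; _≟_)
open import Data.Fin.Properties using (<-cmp; <⇒≢; <-irrelevant)
open import Data.List using (List; []; _∷_; length; map; _++_; filter; filterᵇ; take; allFin; cartesianProduct)
open import Data.List.Properties using (length-++; length-map; length-take; length-removeAt′)
open import Data.List.Membership.Propositional using (_∈_; _∉_; mapWith∈)
open import Data.List.Membership.Propositional.Properties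
  using (∈-map⁺; ∈-map⁻; ∈-++⁺ˡ; ∈-++⁺ʳ; ∈-++⁻; ∈-filter⁺; ∈-filter⁻; ∈-allFin; ∈-cartesianProduct⁺)
open import Data.List.Membership.Setoid.Properties using (length-mapWith∈)
import Data.List.Membership.DecPropositional as DecMembership
open import Data.List.Relation.Binary.Subset.Propositional using (_⊆_)
open import Data.List.Relation.Unary.All as All using (All)
open import Data.List.Relation.Unary.Any as Any using (Any; here; there; index; _─_; satisfied; any?)
open import Data.List.Relation.Unary.Any.Properties using (mapWith∈⁺; mapWith∈⁻)
open import Data.List.Relation.Unary.AllPairs using (AllPairs; []; _∷_)
import Data.List.Relation.Unary.AllPairs.Properties as AllPairs
open import Data.List.Relation.Unary.Unique.Propositional using (Unique)
import Data.List.Relation.Unary.Unique.Propositional.Properties as Unique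
open import Data.Nat.Properties using (<ᵇ⇒<; <⇒<ᵇ; +-identityʳ; +-cancelʳ-≤; m≤n⇒m⊓n≡m; module ≤-Reasoning)
open import Data.Product using (Σ; Σ-syntax; ∃; _×_; _,_; proj₁; proj₂)
open import Data.Sum using (_⊎_; inj₁; inj₂; swap)
open import Function using (_∘_; case_of_)
open import Relation.Binary using (tri<; tri≈; tri>)
open import Relation.Binary.PropositionalEquality as ≡
  using (_≡_; _≢_; refl; trans; cong; cong₂; subst; setoid; module ≡-Reasoning)
open import Relation.Nullary using (Dec; yes; no; does; ¬_; ¬?; _×-dec_)
import Relation.Nullary.Decidable as Dec

module _ {A : Set} where

  ∈-─ : ∀ {x y : A} {ys} (x∈ys : x ∈ ys) → y ∈ ys → y ≢ x → y ∈ (ys ─ x∈ys)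
  ∈-─ (here refl) (here refl) y≢x = ⊥-elim (y≢x refl)
  ∈-─ (here refl) (there y∈ys) _ = y∈ys
  ∈-─ (there _) (here refl) _ = here refl
  ∈-─ (there x∈ys) (there y∈ys) y≢x = there (∈-─ x∈ys y∈ys y≢x)

  Unique⇒length≤ : ∀ {xs ys : List A} → Unique xs → xs ⊆ ys → length xs ≤ length ys
  Unique⇒length≤ {[]} _ _ = z≤n
  Unique⇒length≤ {x ∷ xs} {ys} (x∉xs ∷ xs-unique) xs⊆ys = begin
    1 + length xs              ≤⟨ s≤s (Unique⇒length≤ xs-unique xs⊆ys─x) ⟩
    1 + length (ys ─ x∈ys)     ≡⟨ ≡.sym (length-removeAt′ ys (index x∈ys)) ⟩
    length ys                  ∎
    where
    open ≤-Reasoning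
    x∈ys : x ∈ ys
    x∈ys = xs⊆ys (here refl)
    xs⊆ys─x : xs ⊆ (ys ─ x∈ys)
    xs⊆ys─x y∈xs = ∈-─ x∈ys (xs⊆ys (there y∈xs)) (λ y≡x → All.lookup x∉xs y∈xs (≡.sym y≡x))

  allPairs-lookup : ∀ {R : A → A → Set} {xs x y} → AllPairs R xs → x ∈ xs → y ∈ xs → x ≢ y → R x y ⊎ R y x
  allPairs-lookup (_ ∷ _) (here refl) (here refl) x≢y = ⊥-elim (x≢y refl)
  allPairs-lookup (Rx ∷ _) (here refl) (there y∈xs) _ = inj₁ (All.lookup Rx y∈xs)
  allPairs-lookup (Rx ∷ _) (there x∈xs) (here refl) _ = inj₂ (All.lookup Rx x∈xs)
  allPairs-lookup (_ ∷ Rxs) (there x∈xs) (there y∈xs) x≢y = allPairs-lookup Rxs x∈xs y∈xs x≢y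

  unique⇒allPairs : ∀ {R : A → A → Set} {xs} → (∀ {x y} → x ∈ xs → y ∈ xs → x ≢ y → R x y) →
                    Unique xs → AllPairs R xs
  unique⇒allPairs _ [] = []
  unique⇒allPairs R-distinct (x∉xs ∷ xs-unique) =
    All.tabulate (λ y∈xs → R-distinct (here refl) (there y∈xs) (All.lookup x∉xs y∈xs))
    ∷ unique⇒allPairs (λ x∈ y∈ → R-distinct (there x∈) (there y∈)) xs-unique

  Unique-mapWith∈ : ∀ {B : Set} {xs : List A} (f : ∀ {x} → x ∈ xs → B) → Unique xs →
                    (∀ {x y} (x∈ : x ∈ xs) (y∈ : y ∈ xs) → f x∈ ≡ f y∈ → x ≡ y) →
                    Unique (mapWith∈ xs f)
  Unique-mapWith∈ {xs = []} _ _ _ = []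
  Unique-mapWith∈ {xs = x ∷ xs} f (x∉xs ∷ xs-unique) f-injective =
    All.tabulate fx∉ ∷ Unique-mapWith∈ (f ∘ there) xs-unique (λ x∈ y∈ → f-injective (there x∈) (there y∈))
    where
    fx∉ : ∀ {z} → z ∈ mapWith∈ xs (f ∘ there) → f (here refl) ≢ z
    fx∉ z∈ fx≡z with y , y∈xs , z≡fy ← mapWith∈⁻ xs (f ∘ there) z∈ =
      All.lookup x∉xs y∈xs (f-injective (here refl) (there y∈xs) (trans fx≡z z≡fy))

pattern e¹ e = gad e zero
pattern e² e = gad e (suc zero)
pattern e³ e = gad e (suc (suc zero))
pattern e⁴ e = gad e (suc (suc (suc zero)))

module _ {n : ℕ} (G : Graph n) where

  V : Set
  V = V' G

  NonAdjacent : Fin n → Fin n → Set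
  NonAdjacent i j = adj G i j ≡ false

  edge-adjacency : (e : Edge G) → adj G (lo G e) (hi G e) ≡ true
  edge-adjacency (_ , _ , _ , ij) = ij

  edge-≡ : ∀ {e e' : Edge G} → (lo G e , hi G e) ≡ (lo G e' , hi G e') → e ≡ e'
  edge-≡ {i , j , i<j , ij} {_ , _ , i<j' , ij'} refl =
    cong₂ (λ p q → i , j , p , q) (<-irrelevant i<j i<j') (Decidable⇒UIP.≡-irrelevant Bool._≟_ ij ij')

  -- edgePairs is literally the list counted by numEdges, so length-edges is immediate
  isEdgeᵇ : Fin n × Fin n → Bool
  isEdgeᵇ (i , j) = (toℕ i <ᵇ toℕ j) ∧ adj G i j

  vertexPairs edgePairs : List (Fin n × Fin n)
  vertexPairs = cartesianProduct (allFin n) (allFin n)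
  edgePairs = filterᵇ isEdgeᵇ vertexPairs

  toEdge : (p : Fin n × Fin n) → T (isEdgeᵇ p) → Edge G
  toEdge (i , j) t =
    i , j , <ᵇ⇒< (toℕ i) (toℕ j) (proj₁ i<ᵇj×ij) , Equivalence.to Bool.T-≡ (proj₂ i<ᵇj×ij)
    where
    i<ᵇj×ij : T (toℕ i <ᵇ toℕ j) × T (adj G i j)
    i<ᵇj×ij = Equivalence.to Bool.T-∧ t

  edgeAt : ∀ {p} → p ∈ edgePairs → Edge G
  edgeAt {p} p∈ = toEdge p (proj₂ (∈-filter⁻ (T? ∘ isEdgeᵇ) {xs = vertexPairs} p∈))

  edges : List (Edge G)
  edges = mapWith∈ edgePairs edgeAt

  length-edges : length edges ≡ numEdges G
  length-edges = length-mapWith∈ (setoid _) edgePairs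

  ∈-edges : ∀ e → e ∈ edges
  ∈-edges e@(i , j , i<j , ij) = mapWith∈⁺ edgeAt ((i , j) , ij∈edgePairs , edge-≡ refl)
    where
    ij∈edgePairs : (i , j) ∈ edgePairs
    ij∈edgePairs = ∈-filter⁺ (T? ∘ isEdgeᵇ)
      (∈-cartesianProduct⁺ (∈-allFin i) (∈-allFin j))
      (Equivalence.from Bool.T-∧ (<⇒<ᵇ i<j , Equivalence.from Bool.T-≡ ij))

  edges-unique : Unique edges
  edges-unique = Unique-mapWith∈ edgeAt edgePairs-unique (λ _ _ → cong (λ e → lo G e , hi G e))
    where
    edgePairs-unique : Unique edgePairs
    edgePairs-unique = Unique.filter⁺ (T? ∘ isEdgeᵇ)
      (Unique.cartesianProduct⁺ (Unique.allFin⁺ n) (Unique.allFin⁺ n))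

  length-orig-++-gadgets : ∀ xs (f g : Edge G → V) →
    length (map orig xs ++ map f edges ++ map g edges) ≡ length xs + 2 * numEdges G
  length-orig-++-gadgets xs f g = begin
    length (map orig xs ++ map f edges ++ map g edges)
      ≡⟨ length-++ (map orig xs) ⟩
    length (map orig xs) + length (map f edges ++ map g edges)
      ≡⟨ cong₂ _+_ (length-map orig xs) (length-++ (map f edges)) ⟩
    length xs + (length (map f edges) + length (map g edges))
      ≡⟨ cong (length xs +_) (cong₂ _+_ (length-map f edges) (length-map g edges)) ⟩
    length xs + (length edges + length edges)
      ≡⟨ cong (λ m → length xs + (m + m)) length-edges ⟩
    length xs + (numEdges G + numEdges G)
      ≡⟨ cong (λ m → length xs + (numEdges G + m)) (≡.sym (+-identityʳ (numEdges G))) ⟩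
    length xs + 2 * numEdges G ∎
    where open ≡-Reasoning

  edge-not-within-independent : ∀ {xs} → AllPairs NonAdjacent xs →
    (e : Edge G) → lo G e ∈ xs → hi G e ∈ xs → ⊥
  edge-not-within-independent independent (i , j , i<j , ij) i∈ j∈
    with allPairs-lookup independent i∈ j∈ (<⇒≢ i<j)
  ... | inj₁ ij≡false = case trans (≡.sym ij) ij≡false of λ ()
  ... | inj₂ ji≡false = case trans (≡.sym ij) (trans (sym G i j) ji≡false) of λ ()

  independent-if-edgeless : ∀ {xs} → Unique xs → (∀ e → lo G e ∈ xs → hi G e ∈ xs → ⊥) →
    AllPairs NonAdjacent xs
  independent-if-edgeless {xs} xs-unique edgeless = unique⇒allPairs nonadjacent xs-unique
    where
    nonadjacent : ∀ {i j} → i ∈ xs → j ∈ xs → i ≢ j → NonAdjacent i j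
    nonadjacent {i} {j} i∈ j∈ i≢j with adj G i j in ij
    ... | false = refl
    ... | true with <-cmp i j
    ...   | tri< i<j _ _ = ⊥-elim (edgeless (i , j , i<j , ij) i∈ j∈)
    ...   | tri≈ _ i≡j _ = ⊥-elim (i≢j i≡j)
    ...   | tri> _ _ j<i = ⊥-elim (edgeless (j , i , j<i , trans (sym G j i) ij) j∈ i∈)

  mate : V → V
  mate (orig i) = pend i
  mate (pend i) = orig i
  mate (e¹ e) = e² e
  mate (e² e) = e¹ e
  mate (e³ e) = e⁴ e
  mate (e⁴ e) = e³ e

  mate-involutive : ∀ x → mate (mate x) ≡ x
  mate-involutive (orig _) = refl
  mate-involutive (pend _) = refl
  mate-involutive (e¹ _) = refl
  mate-involutive (e² _) = refl
  mate-involutive (e³ _) = refl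
  mate-involutive (e⁴ _) = refl

  mate-injective : ∀ {x y} → mate x ≡ mate y → x ≡ y
  mate-injective {x} {y} mx≡my =
    trans (≡.sym (mate-involutive x)) (trans (cong mate mx≡my) (mate-involutive y))

  UniquelyMatchedInto : List V → List V → Set
  UniquelyMatchedInto X Y =
    ∀ x → x ∈ X → Σ[ y ∈ V ] (y ∈ Y × Adj' G x y × (∀ y' → y' ∈ Y → Adj' G x y' → y' ≡ y))

  matched-unique : ∀ {X Y x y y'} → UniquelyMatchedInto X Y → x ∈ X → y ∈ Y → y' ∈ Y →
    Adj' G x y → Adj' G x y' → y ≡ y'
  matched-unique {x = x} X→Y x∈X y∈Y y'∈Y x~y x~y' = trans (only _ y∈Y x~y) (≡.sym (only _ y'∈Y x~y'))
    where
    only : ∀ y → y ∈ _ → Adj' G x y → y ≡ proj₁ (X→Y x x∈X)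
    only = proj₂ (proj₂ (proj₂ (X→Y x x∈X)))

  perfectlyMatched-by : (f : V → V) → (∀ {x y} → f x ≡ f y → x ≡ y) →
    ∀ {A} → Unique A →
    (∀ {a} → a ∈ A → Adj' G a (f a)) →
    (∀ {a b} → a ∈ A → b ∈ A → a ≢ f b) →
    (∀ {a b} → a ∈ A → b ∈ A → Adj' G a (f b) → a ≡ b) →
    PerfectlyMatched G A (map f A)
  perfectlyMatched-by f f-injective {A} A-unique adjacent-f A∌f induced =
    A-unique , Unique.map⁺ f-injective A-unique , disjoint , A-matched , fA-matched
    where
    disjoint : ∀ x → x ∈ A → x ∉ map f A
    disjoint x x∈A x∈fA with b , b∈A , refl ← ∈-map⁻ f x∈fA = A∌f x∈A b∈A refl

    A-matched : UniquelyMatchedInto A (map f A)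
    A-matched a a∈A = f a , ∈-map⁺ f a∈A , adjacent-f a∈A , only-f
      where
      only-f : ∀ b' → b' ∈ map f A → Adj' G a b' → b' ≡ f a
      only-f b' b'∈fA a~b' with c , c∈A , refl ← ∈-map⁻ f b'∈fA = cong f (≡.sym (induced a∈A c∈A a~b'))

    fA-matched : UniquelyMatchedInto (map f A) A
    fA-matched b b∈fA with a , a∈A , refl ← ∈-map⁻ f b∈fA =
      a , a∈A , swap (adjacent-f a∈A) , λ a' a'∈A fa~a' → induced a'∈A a∈A (swap fa~a')

  module Forward {S : List (Fin n)} (S-unique : Unique S) (S-independent : AllPairs NonAdjacent S) where

    open DecMembership (_≟_ {n}) using (_∈?_)

    data InA : V → Set where
      orig∈A : ∀ {i} → i ∈ S → InA (orig i)
      e¹∈A : ∀ {e} → hi G e ∉ S → InA (e¹ e)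
      e²∈A : ∀ {e} → hi G e ∈ S → InA (e² e)
      e³∈A : ∀ {e} → hi G e ∈ S → InA (e³ e)
      e⁴∈A : ∀ {e} → hi G e ∉ S → InA (e⁴ e)

    data InB : V → Set where
      pend∈B : ∀ {i} → i ∈ S → InB (pend i)
      e¹∈B : ∀ {e} → hi G e ∈ S → InB (e¹ e)
      e²∈B : ∀ {e} → hi G e ∉ S → InB (e² e)
      e³∈B : ∀ {e} → hi G e ∉ S → InB (e³ e)
      e⁴∈B : ∀ {e} → hi G e ∈ S → InB (e⁴ e)

    InA⇒adjacent-mate : ∀ {a} → InA a → Adj' G a (mate a)
    InA⇒adjacent-mate (orig∈A _) = inj₁ (orig-pend _)
    InA⇒adjacent-mate (e¹∈A _) = inj₁ (path12 _)
    InA⇒adjacent-mate (e²∈A _) = inj₂ (path12 _)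
    InA⇒adjacent-mate (e³∈A _) = inj₁ (path34 _)
    InA⇒adjacent-mate (e⁴∈A _) = inj₂ (path34 _)

    InA⇒InB-mate : ∀ {a} → InA a → InB (mate a)
    InA⇒InB-mate (orig∈A i∈S) = pend∈B i∈S
    InA⇒InB-mate (e¹∈A hi∉S) = e²∈B hi∉S
    InA⇒InB-mate (e²∈A hi∈S) = e¹∈B hi∈S
    InA⇒InB-mate (e³∈A hi∈S) = e⁴∈B hi∈S
    InA⇒InB-mate (e⁴∈A hi∉S) = e³∈B hi∉S

    InA∩InB-empty : ∀ {x} → InA x → InB x → ⊥
    InA∩InB-empty (orig∈A _) ()
    InA∩InB-empty (e¹∈A hi∉S) (e¹∈B hi∈S) = hi∉S hi∈S
    InA∩InB-empty (e²∈A hi∈S) (e²∈B hi∉S) = hi∉S hi∈S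
    InA∩InB-empty (e³∈A hi∈S) (e³∈B hi∉S) = hi∉S hi∈S
    InA∩InB-empty (e⁴∈A hi∉S) (e⁴∈B hi∈S) = hi∉S hi∈S

    adjacent-InB⇒mate : ∀ {a b} → Adj' G a b → InA a → InB b → b ≡ mate a
    adjacent-InB⇒mate (inj₁ (orig-orig _ _ _)) _ ()
    adjacent-InB⇒mate (inj₁ (orig-pend _)) _ _ = refl
    adjacent-InB⇒mate (inj₁ (path12 _)) (e¹∈A _) (e²∈B _) = refl
    adjacent-InB⇒mate (inj₁ (path23 _)) (e²∈A hi∈S) (e³∈B hi∉S) = ⊥-elim (hi∉S hi∈S)
    adjacent-InB⇒mate (inj₁ (path34 _)) (e³∈A _) (e⁴∈B _) = refl
    adjacent-InB⇒mate (inj₁ (lo-e1 e)) (orig∈A lo∈S) (e¹∈B hi∈S) =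
      ⊥-elim (edge-not-within-independent S-independent e lo∈S hi∈S)
    adjacent-InB⇒mate (inj₁ (lo-e4 e)) (orig∈A lo∈S) (e⁴∈B hi∈S) =
      ⊥-elim (edge-not-within-independent S-independent e lo∈S hi∈S)
    adjacent-InB⇒mate (inj₁ (hi-e2 _)) (orig∈A hi∈S) (e²∈B hi∉S) = ⊥-elim (hi∉S hi∈S)
    adjacent-InB⇒mate (inj₁ (hi-e3 _)) (orig∈A hi∈S) (e³∈B hi∉S) = ⊥-elim (hi∉S hi∈S)
    adjacent-InB⇒mate (inj₂ (orig-orig _ _ _)) _ ()
    adjacent-InB⇒mate (inj₂ (orig-pend _)) () _
    adjacent-InB⇒mate (inj₂ (path12 _)) (e²∈A _) (e¹∈B _) = refl
    adjacent-InB⇒mate (inj₂ (path23 _)) (e³∈A hi∈S) (e²∈B hi∉S) = ⊥-elim (hi∉S hi∈S)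
    adjacent-InB⇒mate (inj₂ (path34 _)) (e⁴∈A _) (e³∈B _) = refl
    adjacent-InB⇒mate (inj₂ (lo-e1 _)) _ ()
    adjacent-InB⇒mate (inj₂ (lo-e4 _)) _ ()
    adjacent-InB⇒mate (inj₂ (hi-e2 _)) _ ()
    adjacent-InB⇒mate (inj₂ (hi-e3 _)) _ ()

    lowerSlot upperSlot : Bool → Fin 4
    lowerSlot true = suc zero
    lowerSlot false = zero
    upperSlot true = suc (suc zero)
    upperSlot false = suc (suc (suc zero))

    lowerA upperA : Edge G → V
    lowerA e = gad e (lowerSlot (does (hi G e ∈? S)))
    upperA e = gad e (upperSlot (does (hi G e ∈? S)))

    A : List V
    A = map orig S ++ map lowerA edges ++ map upperA edges

    lowerA-InA : ∀ e → InA (lowerA e)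
    lowerA-InA e with hi G e ∈? S
    ... | yes hi∈S = e²∈A hi∈S
    ... | no hi∉S = e¹∈A hi∉S

    upperA-InA : ∀ e → InA (upperA e)
    upperA-InA e with hi G e ∈? S
    ... | yes hi∈S = e³∈A hi∈S
    ... | no hi∉S = e⁴∈A hi∉S

    ∈A⇒InA : ∀ {a} → a ∈ A → InA a
    ∈A⇒InA a∈A with ∈-++⁻ (map orig S) a∈A
    ... | inj₁ a∈origS with _ , i∈S , refl ← ∈-map⁻ orig a∈origS = orig∈A i∈S
    ... | inj₂ a∈gadgets with ∈-++⁻ (map lowerA edges) a∈gadgets
    ...   | inj₁ a∈lower with e , _ , refl ← ∈-map⁻ lowerA a∈lower = lowerA-InA e
    ...   | inj₂ a∈upper with e , _ , refl ← ∈-map⁻ upperA a∈upper = upperA-InA e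

    A-unique : Unique A
    A-unique = Unique.++⁺ (Unique.map⁺ orig-injective S-unique)
      (Unique.++⁺ (Unique.map⁺ gad-injective edges-unique) (Unique.map⁺ gad-injective edges-unique) lower∩upper)
      orig∩gadgets
      where
      orig-injective : ∀ {i j} → orig {G = G} i ≡ orig j → i ≡ j
      orig-injective refl = refl

      gad-injective : ∀ {e e' t t'} → gad {G = G} e t ≡ gad e' t' → e ≡ e'
      gad-injective refl = refl

      lower≢upper : ∀ {e e'} b b' → gad {G = G} e (lowerSlot b) ≢ gad e' (upperSlot b')
      lower≢upper true true ()
      lower≢upper true false ()
      lower≢upper false true ()
      lower≢upper false false ()

      lower∩upper : ∀ {v} → v ∈ map lowerA edges × v ∈ map upperA edges → ⊥
      lower∩upper (v∈lower , v∈upper) with _ , _ , v≡lower ← ∈-map⁻ lowerA v∈lower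
                                          | _ , _ , v≡upper ← ∈-map⁻ upperA v∈upper =
        lower≢upper _ _ (trans (≡.sym v≡lower) v≡upper)

      orig∩gadgets : ∀ {v} → v ∈ map orig S × v ∈ map lowerA edges ++ map upperA edges → ⊥
      orig∩gadgets (v∈origS , v∈gadgets) with _ , _ , refl ← ∈-map⁻ orig v∈origS
                                             | ∈-++⁻ (map lowerA edges) v∈gadgets
      ... | inj₁ v∈lower = case ∈-map⁻ lowerA v∈lower of λ { (_ , _ , ()) }
      ... | inj₂ v∈upper = case ∈-map⁻ upperA v∈upper of λ { (_ , _ , ()) }

    A-perfectlyMatched : PerfectlyMatched G A (map mate A)
    A-perfectlyMatched = perfectlyMatched-by mate mate-injective A-unique
      (InA⇒adjacent-mate ∘ ∈A⇒InA)
      (λ a∈A b∈A a≡mate-b → InA∩InB-empty (∈A⇒InA a∈A) (subst InB (≡.sym a≡mate-b) (InA⇒InB-mate (∈A⇒InA b∈A))))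
      (λ a∈A b∈A a~mate-b → ≡.sym (mate-injective (adjacent-InB⇒mate a~mate-b (∈A⇒InA a∈A) (InA⇒InB-mate (∈A⇒InA b∈A)))))

    length-A : length A ≡ length S + 2 * numEdges G
    length-A = length-orig-++-gadgets S lowerA upperA

  forward : ∀ {k} → HasIndependentSet G k → HasPMS' G (k + 2 * numEdges G)
  forward (S , S-unique , refl , S-independent) = A , map mate A , A-perfectlyMatched , length-A
    where open Forward S-unique S-independent

  data NotOrig : V → Set where
    pend : ∀ {i} → NotOrig (pend i)
    gad  : ∀ {e t} → NotOrig (gad e t)

  data Charge : V → V → V → Set where
    at-origˡ : ∀ {i b} → Charge (orig i) b (orig i)
    at-origʳ : ∀ {a j} → NotOrig a → Charge a (orig j) (orig j)
    at-e¹ˡ   : ∀ {e} → Charge (e¹ e) (e² e) (e¹ e)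
    at-e¹ʳ   : ∀ {e} → Charge (e² e) (e¹ e) (e¹ e)
    at-e³ˡ   : ∀ {e b} → Charge (e³ e) b (e³ e)
    at-e³ʳ   : ∀ {e a} → Charge a (e³ e) (e³ e)

  charge : ∀ {a b} → Adj' G a b → ∃ (Charge a b)
  charge (inj₁ (orig-orig _ _ _)) = _ , at-origˡ
  charge (inj₁ (orig-pend _)) = _ , at-origˡ
  charge (inj₁ (path12 _)) = _ , at-e¹ˡ
  charge (inj₁ (path23 _)) = _ , at-e³ʳ
  charge (inj₁ (path34 _)) = _ , at-e³ˡ
  charge (inj₁ (lo-e1 _)) = _ , at-origˡ
  charge (inj₁ (lo-e4 _)) = _ , at-origˡ
  charge (inj₁ (hi-e2 _)) = _ , at-origˡ
  charge (inj₁ (hi-e3 _)) = _ , at-origˡ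
  charge (inj₂ (orig-orig _ _ _)) = _ , at-origˡ
  charge (inj₂ (orig-pend _)) = _ , at-origʳ pend
  charge (inj₂ (path12 _)) = _ , at-e¹ʳ
  charge (inj₂ (path23 _)) = _ , at-e³ˡ
  charge (inj₂ (path34 _)) = _ , at-e³ʳ
  charge (inj₂ (lo-e1 _)) = _ , at-origʳ gad
  charge (inj₂ (lo-e4 _)) = _ , at-origʳ gad
  charge (inj₂ (hi-e2 _)) = _ , at-origʳ gad
  charge (inj₂ (hi-e3 _)) = _ , at-origʳ gad

  charge-endpoint : ∀ {a b c} → Charge a b c → c ≡ a ⊎ c ≡ b
  charge-endpoint at-origˡ = inj₁ refl
  charge-endpoint (at-origʳ _) = inj₂ refl
  charge-endpoint at-e¹ˡ = inj₁ refl
  charge-endpoint at-e¹ʳ = inj₂ refl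
  charge-endpoint at-e³ˡ = inj₁ refl
  charge-endpoint at-e³ʳ = inj₂ refl

  _≟-orig_ : (i : Fin n) (v : V) → Dec (orig i ≡ v)
  i ≟-orig orig j = Dec.map′ (cong orig) (λ { refl → refl }) (i ≟ j)
  _ ≟-orig pend _ = no λ ()
  _ ≟-orig gad _ _ = no λ ()

  module Backward {A B : List V} (A-unique : Unique A) (A∩B-empty : ∀ x → x ∈ A → x ∉ B)
                  (A-matched : UniquelyMatchedInto A B) (B-matched : UniquelyMatchedInto B A) where

    partner : ∀ {a} → a ∈ A → V
    partner {a} a∈A = proj₁ (A-matched a a∈A)

    partner∈B : ∀ {a} (a∈A : a ∈ A) → partner a∈A ∈ B
    partner∈B {a} a∈A = proj₁ (proj₂ (A-matched a a∈A))

    partner-adjacent : ∀ {a} (a∈A : a ∈ A) → Adj' G a (partner a∈A)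
    partner-adjacent {a} a∈A = proj₁ (proj₂ (proj₂ (A-matched a a∈A)))

    A-neighbour-unique : ∀ {a b b'} → a ∈ A → b ∈ B → b' ∈ B → Adj' G a b → Adj' G a b' → b ≡ b'
    A-neighbour-unique = matched-unique A-matched

    B-neighbour-unique : ∀ {b a a'} → b ∈ B → a ∈ A → a' ∈ A → Adj' G a b → Adj' G a' b → a ≡ a'
    B-neighbour-unique b∈B a∈A a'∈A a~b a'~b = matched-unique B-matched b∈B a∈A a'∈A (swap a~b) (swap a'~b)

    matched-pairs-disjoint : ∀ {a b a' b' w} → a ∈ A → b ∈ B → Adj' G a b → a' ∈ A → b' ∈ B → Adj' G a' b' →
      w ≡ a ⊎ w ≡ b → w ≡ a' ⊎ w ≡ b' → a ≡ a'
    matched-pairs-disjoint _ _ _ _ _ _ (inj₁ refl) (inj₁ refl) = refl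
    matched-pairs-disjoint a∈A _ _ _ b'∈B _ (inj₁ refl) (inj₂ refl) = ⊥-elim (A∩B-empty _ a∈A b'∈B)
    matched-pairs-disjoint _ b∈B _ a'∈A _ _ (inj₂ refl) (inj₁ refl) = ⊥-elim (A∩B-empty _ a'∈A b∈B)
    matched-pairs-disjoint a∈A b∈B a~b a'∈A _ a'~b' (inj₂ refl) (inj₂ refl) =
      B-neighbour-unique b∈B a∈A a'∈A a~b a'~b'

    charged : ∀ {a} → a ∈ A → V
    charged a∈A = proj₁ (charge (partner-adjacent a∈A))

    charged-view : ∀ {a} (a∈A : a ∈ A) → Charge a (partner a∈A) (charged a∈A)
    charged-view a∈A = proj₂ (charge (partner-adjacent a∈A))

    charges : List V
    charges = mapWith∈ A charged

    charged-injective : ∀ {a a'} (a∈A : a ∈ A) (a'∈A : a' ∈ A) → charged a∈A ≡ charged a'∈A → a ≡ a'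
    charged-injective a∈A a'∈A c≡c' =
      matched-pairs-disjoint a∈A (partner∈B a∈A) (partner-adjacent a∈A)
                             a'∈A (partner∈B a'∈A) (partner-adjacent a'∈A)
        (charge-endpoint (charged-view a∈A))
        (subst (λ w → w ≡ _ ⊎ w ≡ _) (≡.sym c≡c') (charge-endpoint (charged-view a'∈A)))

    charges-unique : Unique charges
    charges-unique = Unique-mapWith∈ charged A-unique charged-injective

    Anchored : Fin n → Set
    Anchored i = orig i ∈ A ⊎ (orig i ∈ B × (∀ {a} → a ∈ A → Adj' G a (orig i) → NotOrig a))

    Charged : Fin n → Set
    Charged i = orig i ∈ charges

    charged⇒anchored : ∀ {i} → Charged i → Anchored i
    charged⇒anchored i∈charges with a , a∈A , i≡c ← mapWith∈⁻ A charged i∈charges =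
      anchored a∈A (partner∈B a∈A) (partner-adjacent a∈A)
        (subst (Charge a (partner a∈A)) (≡.sym i≡c) (charged-view a∈A))
      where
      anchored : ∀ {a b i} → a ∈ A → b ∈ B → Adj' G a b → Charge a b (orig i) → Anchored i
      anchored a∈A _ _ at-origˡ = inj₁ a∈A
      anchored a∈A i∈B a~i (at-origʳ a-notOrig) =
        inj₂ (i∈B , λ a'∈A a'~i → subst NotOrig (B-neighbour-unique i∈B a∈A a'∈A a~i a'~i) a-notOrig)

    e¹-uncharged : ∀ {a b e} → Anchored (lo G e) → Anchored (hi G e) → a ∈ A → b ∈ B → Charge a b (e¹ e) → ⊥
    e¹-uncharged _ (inj₁ hi∈A) e¹∈A e²∈B at-e¹ˡ =
      case B-neighbour-unique e²∈B e¹∈A hi∈A (inj₁ (path12 _)) (inj₁ (hi-e2 _)) of λ ()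
    e¹-uncharged {e = e} (inj₁ lo∈A) (inj₂ (_ , hi-notOrig-neighbours)) _ _ at-e¹ˡ =
      case hi-notOrig-neighbours lo∈A (inj₁ (orig-orig _ _ (edge-adjacency e))) of λ ()
    e¹-uncharged (inj₂ (lo∈B , _)) (inj₂ _) e¹∈A e²∈B at-e¹ˡ =
      case A-neighbour-unique e¹∈A e²∈B lo∈B (inj₁ (path12 _)) (inj₂ (lo-e1 _)) of λ ()
    e¹-uncharged (inj₁ lo∈A) _ e²∈A e¹∈B at-e¹ʳ =
      case B-neighbour-unique e¹∈B e²∈A lo∈A (inj₂ (path12 _)) (inj₁ (lo-e1 _)) of λ ()
    e¹-uncharged {e = e} (inj₂ (_ , lo-notOrig-neighbours)) (inj₁ hi∈A) _ _ at-e¹ʳ =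
      case lo-notOrig-neighbours hi∈A (inj₂ (orig-orig _ _ (edge-adjacency e))) of λ ()
    e¹-uncharged (inj₂ _) (inj₂ (hi∈B , _)) e²∈A e¹∈B at-e¹ʳ =
      case A-neighbour-unique e²∈A e¹∈B hi∈B (inj₂ (path12 _)) (inj₂ (hi-e2 _)) of λ ()

    charged? : (i : Fin n) → Dec (Charged i)
    charged? i = any? (i ≟-orig_) charges

    DoublyCharged : Edge G → Set
    DoublyCharged e = Charged (lo G e) × Charged (hi G e)

    doublyCharged? : (e : Edge G) → Dec (DoublyCharged e)
    doublyCharged? e = charged? (lo G e) ×-dec charged? (hi G e)

    e¹-charged⇒single : ∀ {a b e} → a ∈ A → b ∈ B → Charge a b (e¹ e) → ¬ DoublyCharged e
    e¹-charged⇒single a∈A b∈B e¹-charged (lo-charged , hi-charged) =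
      e¹-uncharged (charged⇒anchored lo-charged) (charged⇒anchored hi-charged) a∈A b∈B e¹-charged

    LowerEndOfDoublyCharged : Fin n → Set
    LowerEndOfDoublyCharged i = Any (λ e → DoublyCharged e × lo G e ≡ i) edges

    lowerEndOfDoublyCharged? : (i : Fin n) → Dec (LowerEndOfDoublyCharged i)
    lowerEndOfDoublyCharged? i = any? (λ e → doublyCharged? e ×-dec (lo G e ≟ i)) edges

    Kept : Fin n → Set
    Kept i = Charged i × ¬ LowerEndOfDoublyCharged i

    kept? : (i : Fin n) → Dec (Kept i)
    kept? i = charged? i ×-dec ¬? (lowerEndOfDoublyCharged? i)

    I : List (Fin n)
    I = filter kept? (allFin n)

    -- no pair is charged to e¹ of a doubly charged edge, so its slot is free for the lower end
    spare : Edge G → V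
    spare e with doublyCharged? e
    ... | yes _ = orig (lo G e)
    ... | no _ = e¹ e

    slots : List V
    slots = map orig I ++ map (λ e → e³ e) edges ++ map spare edges

    spare∈slots : ∀ e → spare e ∈ slots
    spare∈slots e = ∈-++⁺ʳ (map orig I) (∈-++⁺ʳ (map (λ e → e³ e) edges) (∈-map⁺ spare (∈-edges e)))

    lower-end∈slots : ∀ {e} → DoublyCharged e → orig (lo G e) ∈ slots
    lower-end∈slots {e} doubly with doublyCharged? e | spare∈slots e
    ... | yes _ | spare∈ = spare∈
    ... | no single | _ = ⊥-elim (single doubly)

    e¹∈slots : ∀ {e} → ¬ DoublyCharged e → e¹ e ∈ slots
    e¹∈slots {e} single with doublyCharged? e | spare∈slots e
    ... | yes doubly | _ = ⊥-elim (single doubly)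
    ... | no _ | spare∈ = spare∈

    e³∈slots : ∀ e → e³ e ∈ slots
    e³∈slots e = ∈-++⁺ʳ (map orig I) (∈-++⁺ˡ (∈-map⁺ (λ e → e³ e) (∈-edges e)))

    orig∈slots : ∀ {i} → Charged i → orig i ∈ slots
    orig∈slots {i} i-charged with lowerEndOfDoublyCharged? i
    ... | no not-lower-end = ∈-++⁺ˡ (∈-map⁺ orig (∈-filter⁺ kept? (∈-allFin i) (i-charged , not-lower-end)))
    ... | yes lower-end with e , doubly , refl ← satisfied lower-end = lower-end∈slots {e} doubly

    charge∈slots : ∀ {a b c} → a ∈ A → b ∈ B → Charge a b c → c ∈ charges → c ∈ slots
    charge∈slots _ _ at-origˡ c∈ = orig∈slots c∈
    charge∈slots _ _ (at-origʳ _) c∈ = orig∈slots c∈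
    charge∈slots a∈A b∈B at-e¹ˡ _ = e¹∈slots (e¹-charged⇒single a∈A b∈B at-e¹ˡ)
    charge∈slots a∈A b∈B at-e¹ʳ _ = e¹∈slots (e¹-charged⇒single a∈A b∈B at-e¹ʳ)
    charge∈slots _ _ (at-e³ˡ {e}) _ = e³∈slots e
    charge∈slots _ _ (at-e³ʳ {e}) _ = e³∈slots e

    charges⊆slots : charges ⊆ slots
    charges⊆slots c∈charges with a , a∈A , refl ← mapWith∈⁻ A charged c∈charges =
      charge∈slots a∈A (partner∈B a∈A) (charged-view a∈A) c∈charges

    I-unique : Unique I
    I-unique = Unique.filter⁺ kept? (Unique.allFin⁺ n)

    I-independent : AllPairs NonAdjacent I
    I-independent = independent-if-edgeless I-unique λ e lo∈I hi∈I →
      let lo-charged , lo-kept = proj₂ (∈-filter⁻ kept? {xs = allFin n} lo∈I)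
          hi-charged , _ = proj₂ (∈-filter⁻ kept? {xs = allFin n} hi∈I)
      in lo-kept (Any.map (λ { refl → (lo-charged , hi-charged) , refl }) (∈-edges e))

    I-large : ∀ {k} → length A ≡ k + 2 * numEdges G → k ≤ length I
    I-large {k} |A| = +-cancelʳ-≤ (2 * numEdges G) k (length I) (begin
      k + 2 * numEdges G         ≡⟨ ≡.sym |A| ⟩
      length A                   ≡⟨ ≡.sym (length-mapWith∈ (setoid _) A) ⟩
      length charges             ≤⟨ Unique⇒length≤ charges-unique charges⊆slots ⟩
      length slots               ≡⟨ length-orig-++-gadgets I (λ e → e³ e) spare ⟩
      length I + 2 * numEdges G  ∎)
      where open ≤-Reasoning

  backward : ∀ {k} → HasPMS' G (k + 2 * numEdges G) → HasIndependentSet G k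
  backward {k} (_ , _ , (A-unique , _ , A∩B-empty , A-matched , B-matched) , |A|) =
    take k I , Unique.take⁺ k I-unique , trans (length-take k I) (m≤n⇒m⊓n≡m (I-large |A|)) ,
    AllPairs.take⁺ k I-independent
    where open Backward A-unique A∩B-empty A-matched B-matched

proposition6 : (n : ℕ) (G : Graph n) (k : ℕ) →
    HasIndependentSet G k ⇔ HasPMS' G (k + 2 * numEdges G)
proposition6 n G k = mk⇔ (forward G) (backward G)
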